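{- Let $\mathcal{E}$ and $\mathcal{E}'$ be non-empty, closed, well-formed Boolean equation systems. If the reduced structure graphs $\mathcal{R}_{\mathcal{E}}$ and $\mathcal{R}_{\mathcal{E}'}$ are bisimilar, then the normalised structure graphs $\mathcal{N}_{\mathcal{E}}$ and $\mathcal{N}_{\mathcal{E}'}$ are bisimilar.
   Context: Fix a set $\mathcal{X}$ of proposition variables. Proposition formulae: $f,g ::= \mathsf{true}\mid\mathsf{false}\mid X\mid f\vee g\mid f\wedge g$. A BES is a finite sequence of equations $(\sigma X=f)$, $\sigma\in\{\mu,\nu\}$; $\mathrm{bnd}$: left-hand-side variables; $\mathrm{occ}$: variables in right-hand sides; closed: $\mathrm{occ}(\mathcal{E})\subseteq\mathrm{bnd}(\mathcal{E})$; well-formed: each variable is a left-hand side at most once. Rank: $\mathrm{rank}(X)=c_\nu(X,\mathcal{E})$ with $c_\sigma(X,\epsilon)=0$; $c_\sigma(X,(\sigma'Y=f)\mathcal{E}')=0$ if $\sigma=\sigma'$, $X=Y$; $=c_\sigma(X,\mathcal{E}')$ if $\sigma=\sigma'$, $X\ne Y$; $=1+c_{\sigma'}(X,(\sigma'Y=f)\mathcal{E}')$ if $\sigma\ne\sigma'$. Structure graphs $\langle T,t,\to,d\rangle$: finite node set $T$, initial $t$, $\to\subseteq T\times T$, $d(u)\subseteq\mathbb{N}\cup\{\blacktriangle,\blacktriangledown,\top,\bot\}$; the graph generated from a term $s$ by rules has nodes all terms reachable from $s$ via $\to$, and $d(u)$ = decoration symbols whose predicate holds for $u$ plus all $n$ with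 $u\pitchfork n$. Bisimulation: $R\subseteq T\times T'$ with, for $(u,u')\in R$, $d(u)=d'(u')$ and each transition of one matched by a transition of the other to an $R$-related node; graphs are bisimilar if a bisimulation relates their initial nodes. Basic rules on formulae (least predicates, then least $\to$): $\mathsf{true}\top$; $\mathsf{false}\bot$; $(t\wedge t')\blacktriangle$; $(t\vee t')\blacktriangledown$; $X\blacktriangle$ (resp. $\blacktriangledown$) if $(\sigma X=t)\in\mathcal{E}$ and $t\blacktriangle$ (resp. $t\blacktriangledown$); $X\pitchfork n$ if $X\in\mathrm{bnd}(\mathcal{E})$, $\mathrm{rank}(X)=n$; if $t\blacktriangle$, $t\to u$ then $t\wedge t'\to u$; if $t'\blacktriangle$, $t'\to u'$ then $t\wedge t'\to u'$; analogously for $\vee$ with $\blacktriangledown$; if not $t\blacktriangle$ then $t\wedge t'\to t$; if not $t'\blacktriangle$ then $t\wedge t'\to t'$; if not $t\blacktriangledown$ then $t\vee t'\to t$; if not $t'\blacktriangledown$ then $t\vee t'\to t'$; if $(\sigma X=t)\in\mathcal{E}$ and neither $t\blacktriangle$ nor $t\blacktriangledown$ then $X\to t$; if $(\sigma X=t)\in\mathcal{E}$, ($t\blacktriangle$ or $t\blacktriangledown$) and $t\to u$ then $X\to u$. Reduce rules: $\mathsf{reduce}(t)\blacktriangle$ if $t\blacktriangle$; $\mathsf{reduce}(t)\blacktriangledown$ if $t\blacktriangledown$; if neither $t\top$ nor $t\bot$: $t\to u$ implies $\mathsf{reduce}(t)\to\mathsf{reduce}(u)$, and $t\pitchfork n$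 implies $\mathsf{reduce}(t)\pitchfork n$; if $t\top$: $\mathsf{reduce}(t)\to\mathsf{reduce}(t)$ and $\mathsf{reduce}(t)\pitchfork 0$; if $t\bot$: $\mathsf{reduce}(t)\to\mathsf{reduce}(t)$ and $\mathsf{reduce}(t)\pitchfork 1$. $\mathcal{R}_{\mathcal{E}}$ is generated from $\mathsf{reduce}(X_0)$, $X_0$ the left-hand side of the first equation of $\mathcal{E}$. Normalise rules, on $\mathsf{normalise}(s)$ for reduce-terms $s$: $\mathsf{normalise}(s)\blacktriangle$ if $s\blacktriangle$; $\mathsf{normalise}(s)\blacktriangledown$ if $s\blacktriangledown$; $\mathsf{normalise}(s)\to\mathsf{normalise}(u)$ if $s\to u$; $\mathsf{normalise}(s)\pitchfork n$ if $s\pitchfork n$; if $s$ has no rank, $s\to u$, $\mathsf{normalise}(u)\pitchfork n$, and every $v$ with $s\to v$ has $\mathsf{normalise}(v)\pitchfork m$ for some $m\le n$, then $\mathsf{normalise}(s)\pitchfork n$ (least such predicate). $\mathcal{N}_{\mathcal{E}}$ is generated from $\mathsf{normalise}(\mathsf{reduce}(X_0))$. -}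

module Defs where

open import Level using (Level; _⊔_) renaming (suc to lsuc; zero to lzero)
open import Data.Nat using (ℕ; zero; suc; _≤_)
open import Data.Product using (Σ; ∃; _×_; _,_)
open import Data.Sum using (_⊎_)
open import Data.List using (List; []; _∷_; map)
open import Data.List.Membership.Propositional using (_∈_)
open import Data.List.Relation.Unary.Unique.Propositional using (Unique)
open import Relation.Nullary using (¬_)
open import Relation.Binary.PropositionalEquality using (_≡_; _≢_)
open import Relation.Binary.Construct.Closure.ReflexiveTransitive using (Star)
open import Function.Bundles using (_⇔_)

data Deco : Set where
  rankD : ℕ → Deco
  conjD : Deco
  disjD : Deco
  topD  : Deco
  botD  : Deco

record StructureGraph : Set₁ where
  field
    Node : Set
    init : Node
    _⟶_  : Node → Node → Set
    d    : Node → Deco → Set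

record IsBisimulation (G G' : StructureGraph)
         (R : StructureGraph.Node G → StructureGraph.Node G' → Set) : Set where
  open StructureGraph G
  open StructureGraph G' renaming (Node to Node'; _⟶_ to _⟶'_; d to d')
  field
    sameDeco : ∀ u u' → R u u' → ∀ δ → (d u δ ⇔ d' u' δ)
    forth    : ∀ u u' → R u u' → ∀ v → u ⟶ v → Σ Node' (λ v' → (u' ⟶' v') × R v v')
    back     : ∀ u u' → R u u' → ∀ v' → u' ⟶' v' → Σ Node (λ v → (u ⟶ v) × R v v')

Bisimilar : StructureGraph → StructureGraph → Set₁
Bisimilar G G' = Σ (StructureGraph.Node G → StructureGraph.Node G' → Set) λ R →
  IsBisimulation G G' R × R (StructureGraph.init G) (StructureGraph.init G')

generated : {Term : Set} → (Term → Term → Set) → (Term → Deco → Set) → Term → StructureGraph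
generated {Term} step deco s = record
  { Node = Σ Term (λ u → Star step s u)
  ; init = s , Star.ε
  ; _⟶_  = λ { (u , _) (v , _) → step u v }
  ; d    = λ { (u , _) δ → deco u δ }
  }

data Fixpoint : Set where
  μ ν : Fixpoint

module _ {𝒳 : Set} where

  data Form : Set where
    true false : Form
    var : 𝒳 → Form
    _∨_ _∧_ : Form → Form → Form

  record Equation : Set where
    constructor eqn
    field
      sign : Fixpoint
      lhs  : 𝒳
      rhs  : Form

  BES : Set
  BES = List Equation

  Bnd : BES → 𝒳 → Set
  Bnd E X = X ∈ map Equation.lhs E

  data OccIn (X : 𝒳) : Form → Set where
    occ-var : OccIn X (var X)
    occ-∨l : ∀ {f g} → OccIn X f → OccIn X (f ∨ g)
    occ-∨r : ∀ {f g} → OccIn X g → OccIn X (f ∨ g)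
    occ-∧l : ∀ {f g} → OccIn X f → OccIn X (f ∧ g)
    occ-∧r : ∀ {f g} → OccIn X g → OccIn X (f ∧ g)

  Occ : BES → 𝒳 → Set
  Occ E X = Σ Equation λ e → e ∈ E × OccIn X (Equation.rhs e)

  Closed : BES → Set
  Closed E = ∀ X → Occ E X → Bnd E X

  WellFormed : BES → Set
  WellFormed E = Unique (map Equation.lhs E)

  data NonEmpty : BES → Set where
    nonEmpty : ∀ e es → NonEmpty (e ∷ es)

  X₀ : ∀ {E} → NonEmpty E → 𝒳
  X₀ (nonEmpty e _) = Equation.lhs e

  data C (σ : Fixpoint) (X : 𝒳) : BES → ℕ → Set where
    c-nil  : C σ X [] 0
    c-here : ∀ {f E} → C σ X (eqn σ X f ∷ E) 0
    c-skip : ∀ {Y f E n} → X ≢ Y → C σ X E n → C σ X (eqn σ Y f ∷ E) n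
    c-flip : ∀ {σ' Y f E n} → σ ≢ σ' → C σ' X (eqn σ' Y f ∷ E) n
           → C σ X (eqn σ' Y f ∷ E) (suc n)

  Rank : BES → 𝒳 → ℕ → Set
  Rank E X n = C ν X E n

  module Basic (E : BES) where

    data Conj : Form → Set where
      conj-∧   : ∀ {t t'} → Conj (t ∧ t')
      conj-var : ∀ {σ X t} → eqn σ X t ∈ E → Conj t → Conj (var X)

    data Disj : Form → Set where
      disj-∨   : ∀ {t t'} → Disj (t ∨ t')
      disj-var : ∀ {σ X t} → eqn σ X t ∈ E → Disj t → Disj (var X)

    data Top : Form → Set where
      top : Top true
    data Bot : Form → Set where
      bot : Bot false

    data HasRank : Form → ℕ → Set where
      rank-var : ∀ {X n} → Bnd E X → Rank E X n → HasRank (var X) n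

    data Step : Form → Form → Set where
      ∧-l  : ∀ {t t' u} → Conj t → Step t u → Step (t ∧ t') u
      ∧-r  : ∀ {t t' u} → Conj t' → Step t' u → Step (t ∧ t') u
      ∨-l  : ∀ {t t' u} → Disj t → Step t u → Step (t ∨ t') u
      ∨-r  : ∀ {t t' u} → Disj t' → Step t' u → Step (t ∨ t') u
      ∧-nl : ∀ {t t'} → ¬ Conj t → Step (t ∧ t') t
      ∧-nr : ∀ {t t'} → ¬ Conj t' → Step (t ∧ t') t'
      ∨-nl : ∀ {t t'} → ¬ Disj t → Step (t ∨ t') t
      ∨-nr : ∀ {t t'} → ¬ Disj t' → Step (t ∨ t') t'
      var-n : ∀ {σ X t} → eqn σ X t ∈ E → ¬ Conj t → ¬ Disj t → Step (var X) t
      var-c : ∀ {σ X t u} → eqn σ X t ∈ E → (Conj t ⊎ Disj t) → Step t u → Step (var X) u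

    -- reduce(t): a reduce-term is represented by the formula t it wraps.

    data RStep : Form → Form → Set where
      r-step : ∀ {t u} → ¬ Top t → ¬ Bot t → Step t u → RStep t u
      r-top  : ∀ {t} → Top t → RStep t t
      r-bot  : ∀ {t} → Bot t → RStep t t

    data RRank : Form → ℕ → Set where
      r-rank : ∀ {t n} → ¬ Top t → ¬ Bot t → HasRank t n → RRank t n
      r-top  : ∀ {t} → Top t → RRank t 0
      r-bot  : ∀ {t} → Bot t → RRank t 1

    data RDeco (t : Form) : Deco → Set where
      d-conj : Conj t → RDeco t conjD
      d-disj : Disj t → RDeco t disjD
      d-rank : ∀ {n} → RRank t n → RDeco t (rankD n)

    -- normalise(reduce(t)): represented by the formula t.

    data NRank (s : Form) : ℕ → Set where
      n-rank : ∀ {n} → RRank s n → NRank s n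
      n-derived : ∀ {u n} → ¬ (Σ ℕ (RRank s)) → RStep s u → NRank u n
                → (∀ v → RStep s v → Σ ℕ λ m → m ≤ n × NRank v m)
                → NRank s n

    data NDeco (s : Form) : Deco → Set where
      d-conj : Conj s → NDeco s conjD
      d-disj : Disj s → NDeco s disjD
      d-rank : ∀ {n} → NRank s n → NDeco s (rankD n)

  ReducedGraph : (E : BES) → NonEmpty E → StructureGraph
  ReducedGraph E ne = generated (Basic.RStep E) (Basic.RDeco E) (var (X₀ ne))

  NormalisedGraph : (E : BES) → NonEmpty E → StructureGraph
  NormalisedGraph E ne = generated (Basic.RStep E) (Basic.NDeco E) (var (X₀ ne))

module Submission where

-- The reduced graph and the normalised graph generated from a formula share
-- their nodes and transitions; they differ only in the rank decorations,
-- where the normalised graph adds ranks derived by the rule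
-- "s has no rank, s → u with normalise(u) ⋔ n, and every successor of s has
-- a normalised rank ≤ n".  Such derived ranks are defined purely in terms of
-- the reduced ranks and the transitions, so they are carried across any
-- bisimulation of reduced graphs.  Consequently the very same relation that
-- witnesses bisimilarity of the reduced graphs witnesses bisimilarity of the
-- normalised graphs.

open import Defs
open import Data.Nat using (ℕ; _≤_)
open import Relation.Nullary using (¬_)
open import Data.Product using (Σ; _×_; _,_; proj₁)
open import Function.Bundles using (mk⇔; Equivalence)
open import Function.Properties.Equivalence using () renaming (sym to ⇔-sym)
open import Relation.Binary.Construct.Closure.ReflexiveTransitive using (Star; ε; _◅_; _◅◅_)

converse : ∀ {G G'} {R : StructureGraph.Node G → StructureGraph.Node G' → Set}
         → IsBisimulation G G' R → IsBisimulation G' G (λ u' u → R u u')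
converse isB = record
  { sameDeco = λ u' u r δ → ⇔-sym (sameDeco u u' r δ)
  ; forth    = λ u' u r → back u u' r
  ; back     = λ u' u r → forth u u' r
  }
  where open IsBisimulation isB

module _ {𝒳 : Set} (E : BES {𝒳}) where
  open Basic E

  rdeco-conj : ∀ {t} → RDeco t conjD → Conj t
  rdeco-conj (d-conj c) = c

  rdeco-disj : ∀ {t} → RDeco t disjD → Disj t
  rdeco-disj (d-disj c) = c

  rdeco-rank : ∀ {t n} → RDeco t (rankD n) → RRank t n
  rdeco-rank (d-rank r) = r

  extend : ∀ {s t u} → Star RStep s t → RStep t u → Star RStep s u
  extend p st = p ◅◅ (st ◅ ε)

Reduced Normalised : {𝒳 : Set} → BES {𝒳} → Form {𝒳} → StructureGraph
Reduced    E s = generated (Basic.RStep E) (Basic.RDeco E) s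
Normalised E s = generated (Basic.RStep E) (Basic.NDeco E) s

module Transfer {𝒳 : Set} {E E' : BES {𝒳}} {s s' : Form {𝒳}}
  {R : StructureGraph.Node (Reduced E s) → StructureGraph.Node (Reduced E' s') → Set}
  (isB : IsBisimulation (Reduced E s) (Reduced E' s') R)
  where
  open IsBisimulation isB
  open Basic

  rdeco : ∀ {u u'} → R u u' → ∀ δ → RDeco E (proj₁ u) δ → RDeco E' (proj₁ u') δ
  rdeco r δ = Equivalence.to (sameDeco _ _ r δ)

  rdeco⁻ : ∀ {u u'} → R u u' → ∀ δ → RDeco E' (proj₁ u') δ → RDeco E (proj₁ u) δ
  rdeco⁻ r δ = Equivalence.from (sameDeco _ _ r δ)

  -- Derived normalised ranks are transported: each ingredient of the rule
  -- (absence of a reduced rank, a chosen successor, the bound on all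
  -- successors) is matched across R using sameDeco, forth and back.
  nrank : ∀ {u u' n} → R u u' → NRank E (proj₁ u) n → NRank E' (proj₁ u') n
  nrank r (n-rank x) = n-rank (rdeco-rank E' (rdeco r _ (d-rank x)))
  nrank {t , p} {t' , p'} {n} r (n-derived noRank st nu bounded)
    with forth _ _ r (_ , extend E p st) st
  ... | v' , st' , rv = n-derived noRank' st' (nrank rv nu) bounded'
    where
    noRank' : ¬ Σ ℕ (RRank E' t')
    noRank' (m , x) = noRank (m , rdeco-rank E (rdeco⁻ r _ (d-rank x)))

    bounded' : ∀ w' → RStep E' t' w' → Σ ℕ λ m → m ≤ n × NRank E' w' m
    bounded' w' sw' with back _ _ r (w' , extend E' p' sw') sw'
    ... | (w , _) , sw , rw with bounded w sw
    ...   | m , m≤n , nw = m , m≤n , nrank rw nw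

  ndeco : ∀ {u u'} → R u u' → ∀ δ → NDeco E (proj₁ u) δ → NDeco E' (proj₁ u') δ
  ndeco r _ (d-conj c) = d-conj (rdeco-conj E' (rdeco r _ (d-conj c)))
  ndeco r _ (d-disj c) = d-disj (rdeco-disj E' (rdeco r _ (d-disj c)))
  ndeco r _ (d-rank x) = d-rank (nrank r x)

normalised-bisimulation : ∀ {𝒳} {E E' : BES {𝒳}} {s s'}
  {R : StructureGraph.Node (Reduced E s) → StructureGraph.Node (Reduced E' s') → Set}
  → IsBisimulation (Reduced E s) (Reduced E' s') R
  → IsBisimulation (Normalised E s) (Normalised E' s') R
normalised-bisimulation isB = record
  { sameDeco = λ u u' r δ → mk⇔ (Transfer.ndeco isB r δ)
                                 (Transfer.ndeco (converse isB) r δ)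
  ; forth    = forth
  ; back     = back
  }
  where open IsBisimulation isB

-- Theorem 6.
mainTheorem6 : {𝒳 : Set} (E E' : BES {𝒳}) (ne : NonEmpty E) (ne' : NonEmpty E')
    → Closed E → WellFormed E → Closed E' → WellFormed E'
    → Bisimilar (ReducedGraph E ne) (ReducedGraph E' ne')
    → Bisimilar (NormalisedGraph E ne) (NormalisedGraph E' ne')
mainTheorem6 E E' ne ne' _ _ _ _ (R , isB , related) =
  R , normalised-bisimulation isB , related
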